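{- Let $\pi\in S_n$. Suppose there exists $i\in[n-1]$ such that $i$ occurs before $i+1$ in $\pi$ but not immediately before $i+1$. Let $\pi'$ be the permutation obtained by swapping the entries $i$ and $i+1$ in $\pi$. Then $|\operatorname{SC}_{132}^{ -1}(\pi)|\le|\operatorname{SC}_{132}^{ -1}(\pi')|$.
   Context: $S_n$ is the set of permutations of $[n]$ in one-line notation. Two sequences of distinct integers have the same relative order if replacing the $i$th smallest entry of each by $i$ yields the same word; a sequence avoids $132$ consecutively if no consecutive subsequence has the same relative order as $132$. $\operatorname{SC}_{132}:S_n\to S_n$ sends a permutation through a stack: at each step, if there is a next input entry and placing it on top of the stack would make the stack contents, read top to bottom, avoid $132$ consecutively, push it; otherwise pop the top entry of the stack to the end of the output; stop when the output has length $n$. $\operatorname{SC}_{132}^{ -1}(\pi)$ is the set of preimages of $\pi$ in $S_n$. -}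

module Defs where

open import Data.Nat using (ℕ; zero; suc; _<ᵇ_; _≡ᵇ_; _≤_)
open import Data.Nat.Properties using (_≟_)
open import Data.Bool using (Bool; true; false; if_then_else_; not; _∧_)
open import Data.List using (List; []; _∷_; _++_; map; concatMap; filter; length; upTo)
open import Data.Product using (_×_; _,_)
open import Data.List.Relation.Unary.Unique.DecPropositional _≟_ using (Unique; unique?)
open import Data.List.Relation.Binary.Equality.DecPropositional _≟_ using (_≡?_)

[_] : ℕ → List ℕ
[ n ] = map suc (upTo n)

words : List ℕ → ℕ → List (List ℕ)
words as zero    = [] ∷ []
words as (suc k) = concatMap (λ a → map (a ∷_) (words as k)) as

-- S_n in one-line notation: words of length n over [n] with distinct entries
Sn : ℕ → List (List ℕ)
Sn n = filter unique? (words [ n ] n)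

avoids132 : List ℕ → Bool
avoids132 (a ∷ b ∷ c ∷ rest) =
  not ((a <ᵇ c) ∧ (c <ᵇ b)) ∧ avoids132 (b ∷ c ∷ rest)
avoids132 _ = true

-- stack is a list read top to bottom (head = top).
-- popUntil x st : pop entries from st (to the output, in order) until
-- pushing x onto the remaining stack keeps it consecutively 132-avoiding.
popUntil : ℕ → List ℕ → List ℕ × List ℕ
popUntil x [] = [] , []
popUntil x (t ∷ st) with avoids132 (x ∷ t ∷ st)
... | true  = [] , t ∷ st
... | false with popUntil x st
...   | out , st' = t ∷ out , st'

run : List ℕ → List ℕ → List ℕ
run [] st = st
run (x ∷ xs) st with popUntil x st
... | out , st' = out ++ run xs (x ∷ st')

SC132 : List ℕ → List ℕ
SC132 σ = run σ []

preimageCount : ℕ → List ℕ → ℕ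
preimageCount n π = length (filter (λ σ → SC132 σ ≡? π) (Sn n))

swapVals : ℕ → List ℕ → List ℕ
swapVals i = map (λ x → if x ≡ᵇ i then suc i else (if x ≡ᵇ suc i then i else x))

-- SC₁₃₂ commutes with exchanging the values i and i+1 whenever its output has i
-- before i+1 and not adjacent to it.  The stack only compares values, and the
-- exchange changes only comparisons between i and i+1.  A push test compares the
-- incoming entry with the second stack entry and that one with the top, so it sees
-- i against i+1 only if they are the top two entries, or if one of them is pushed
-- while the other is second.  Unless the outcome of the test is unaffected, each such
-- situation ends with i+1 output before i, or with i directly above i+1 on the stack;
-- then every later push is allowed (a consecutive 132 would need i+1 < i), so the two
-- are output adjacently.  Hence exchanging i and i+1 in σ maps SC₁₃₂⁻¹(π) injectively
-- into SC₁₃₂⁻¹(π').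
module Submission where

open import Defs
open import Data.Nat using (ℕ; zero; suc; _+_; _≤_; _<_; _<ᵇ_; _≡ᵇ_; z≤n; s≤s)
open import Data.Nat.Properties using (_≟_; suc-injective; n≤1+n; 1+n≢n; <⇒≤; +-suc)
open import Data.Bool using (true; false; not; _∧_; if_then_else_)
open import Data.Bool.Properties using (∧-zeroʳ; ∧-conicalʳ; ¬-not) renaming (_≟_ to _≟ᵇ_)
open import Data.Product using (_×_; _,_; proj₁; proj₂)
open import Data.Sum using (inj₁; inj₂)
open import Data.Empty using (⊥-elim)
open import Data.List using (List; []; _∷_; _++_; map; filter; length; concatMap; cartesianProductWith)
open import Data.List.Properties using (length-map; length-++; map-injective; ∷-injective)
open import Data.List.Membership.Propositional using (_∈_)
open import Data.List.Membership.Propositional.Properties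
  using (∈-∃++; ∈-++⁻; ∈-++⁺ˡ; ∈-++⁺ʳ; ∈-map⁺; ∈-map⁻; ∈-filter⁺; ∈-filter⁻; ∈-upTo⁺;
         ∈-cartesianProductWith⁺; ∈-cartesianProductWith⁻)
open import Data.List.Relation.Unary.Any using (here; there)
import Data.List.Relation.Unary.All as All
open import Data.List.Relation.Unary.AllPairs using ([]; _∷_)
open import Data.List.Relation.Unary.Unique.Propositional using (Unique)
import Data.List.Relation.Unary.Unique.Propositional.Properties as Unique
open import Data.List.Relation.Unary.Unique.DecPropositional _≟_ using (unique?)
open import Data.List.Relation.Binary.Equality.DecPropositional _≟_ using (_≡?_)
open import Data.List.Relation.Binary.Sublist.Propositional
  using (_⊆_; []; _∷_; _∷ʳ_; ⊆-refl; ⊆-trans; minimum; lookup)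
open import Data.List.Relation.Binary.Sublist.Propositional.Properties using (∷ˡ⁻; ++⁺ˡ)
open import Data.List.Relation.Binary.Infix.Heterogeneous using (Infix; here; there; _++ⁱ_)
open import Data.List.Relation.Binary.Prefix.Heterogeneous using ([]; _∷_)
open import Relation.Nullary using (¬_; yes; no)
open import Relation.Unary using (Decidable)
open import Relation.Binary.PropositionalEquality hiding ([_])
open ≡-Reasoning

≡ᵇ-refl : ∀ n → (n ≡ᵇ n) ≡ true
≡ᵇ-refl zero    = refl
≡ᵇ-refl (suc n) = ≡ᵇ-refl n

≢⇒≡ᵇ-false : ∀ {m n} → m ≢ n → (m ≡ᵇ n) ≡ false
≢⇒≡ᵇ-false {zero}  {zero}  m≢n = ⊥-elim (m≢n refl)
≢⇒≡ᵇ-false {zero}  {suc n} _   = refl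
≢⇒≡ᵇ-false {suc m} {zero}  _   = refl
≢⇒≡ᵇ-false {suc m} {suc n} m≢n = ≢⇒≡ᵇ-false (λ m≡n → m≢n (cong suc m≡n))

n<ᵇ1+n : ∀ n → (n <ᵇ suc n) ≡ true
n<ᵇ1+n zero    = refl
n<ᵇ1+n (suc n) = n<ᵇ1+n n

n≮ᵇn : ∀ n → (n <ᵇ n) ≡ false
n≮ᵇn zero    = refl
n≮ᵇn (suc n) = n≮ᵇn n

≤⇒≮ᵇ : ∀ {m n} → m ≤ n → (n <ᵇ m) ≡ false
≤⇒≮ᵇ z≤n       = refl
≤⇒≮ᵇ (s≤s m≤n) = ≤⇒≮ᵇ m≤n

<ᵇ-1+-right : ∀ {a i} → a ≢ i → (a <ᵇ suc i) ≡ (a <ᵇ i)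
<ᵇ-1+-right {zero}  {zero}  a≢i = ⊥-elim (a≢i refl)
<ᵇ-1+-right {zero}  {suc i} _   = refl
<ᵇ-1+-right {suc a} {zero}  _   = refl
<ᵇ-1+-right {suc a} {suc i} a≢i = <ᵇ-1+-right (λ a≡i → a≢i (cong suc a≡i))

<ᵇ-1+-left : ∀ {i c} → c ≢ suc i → (suc i <ᵇ c) ≡ (i <ᵇ c)
<ᵇ-1+-left {c = zero}  _     = refl
<ᵇ-1+-left {c = suc c} c≢1+i = sym (<ᵇ-1+-right (λ i≡c → c≢1+i (cong suc (sym i≡c))))

nothing-between : ∀ i x → ((i <ᵇ x) ∧ (x <ᵇ suc i)) ≡ false
nothing-between zero    zero    = refl
nothing-between zero    (suc x) = refl
nothing-between (suc i) zero    = refl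
nothing-between (suc i) (suc x) = nothing-between i x

∧-false-right : ∀ a {b} → b ≡ false → (a ∧ b) ≡ false
∧-false-right a refl = ∧-zeroʳ a

swapVal : ℕ → ℕ → ℕ
swapVal i x = if x ≡ᵇ i then suc i else (if x ≡ᵇ suc i then i else x)

module _ (i : ℕ) where

  swapVal-lower : swapVal i i ≡ suc i
  swapVal-lower rewrite ≡ᵇ-refl i = refl

  swapVal-upper : swapVal i (suc i) ≡ i
  swapVal-upper rewrite ≢⇒≡ᵇ-false (1+n≢n {i}) | ≡ᵇ-refl i = refl

  swapVal-other : ∀ {x} → x ≢ i → x ≢ suc i → swapVal i x ≡ x
  swapVal-other x≢i x≢1+i rewrite ≢⇒≡ᵇ-false x≢i | ≢⇒≡ᵇ-false x≢1+i = refl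

  swapVal-involutive : ∀ x → swapVal i (swapVal i x) ≡ x
  swapVal-involutive x with x ≟ i | x ≟ suc i
  ... | yes refl | _        = trans (cong (swapVal i) swapVal-lower) swapVal-upper
  ... | no _     | yes refl = trans (cong (swapVal i) swapVal-upper) swapVal-lower
  ... | no x≢i   | no x≢1+i = trans (cong (swapVal i) (swapVal-other x≢i x≢1+i)) (swapVal-other x≢i x≢1+i)

  swapVal-injective : ∀ {x y} → swapVal i x ≡ swapVal i y → x ≡ y
  swapVal-injective {x} {y} eq =
    trans (sym (swapVal-involutive x)) (trans (cong (swapVal i) eq) (swapVal-involutive y))

  swapVal-∈ : ∀ {a xs} → i ∈ xs → suc i ∈ xs → a ∈ xs → swapVal i a ∈ xs
  swapVal-∈ {a} i∈ 1+i∈ a∈ with a ≟ i | a ≟ suc i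
  ... | yes refl | _        = subst (_∈ _) (sym swapVal-lower) 1+i∈
  ... | no _     | yes refl = subst (_∈ _) (sym swapVal-upper) i∈
  ... | no a≢i   | no a≢1+i = subst (_∈ _) (sym (swapVal-other a≢i a≢1+i)) a∈

  data OrderUnderSwap : ℕ → ℕ → Set where
    kept    : ∀ {a c} → (swapVal i a <ᵇ swapVal i c) ≡ (a <ᵇ c) → OrderUnderSwap a c
    ascent  : OrderUnderSwap i (suc i)
    descent : OrderUnderSwap (suc i) i

  private
    kept′ : ∀ {a c a′ c′} → swapVal i a ≡ a′ → swapVal i c ≡ c′ → (a′ <ᵇ c′) ≡ (a <ᵇ c) →
            OrderUnderSwap a c
    kept′ refl refl eq = kept eq

  orderUnderSwap : ∀ a c → OrderUnderSwap a c
  orderUnderSwap a c with a ≟ i | a ≟ suc i | c ≟ i | c ≟ suc i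
  ... | yes refl | _        | yes refl | _        = kept (trans (n≮ᵇn (swapVal i i)) (sym (n≮ᵇn i)))
  ... | yes refl | _        | no _     | yes refl = ascent
  ... | yes refl | _        | no c≢i   | no c≢1+i =
    kept′ swapVal-lower (swapVal-other c≢i c≢1+i) (<ᵇ-1+-left c≢1+i)
  ... | no _     | yes refl | yes refl | _        = descent
  ... | no _     | yes refl | no _     | yes refl =
    kept (trans (n≮ᵇn (swapVal i (suc i))) (sym (n≮ᵇn (suc i))))
  ... | no _     | yes refl | no c≢i   | no c≢1+i =
    kept′ swapVal-upper (swapVal-other c≢i c≢1+i) (sym (<ᵇ-1+-left c≢1+i))
  ... | no a≢i   | no a≢1+i | yes refl | _        =
    kept′ (swapVal-other a≢i a≢1+i) swapVal-lower (<ᵇ-1+-right a≢i)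
  ... | no a≢i   | no a≢1+i | no _     | yes refl =
    kept′ (swapVal-other a≢i a≢1+i) swapVal-upper (sym (<ᵇ-1+-right a≢i))
  ... | no a≢i   | no a≢1+i | no c≢i   | no c≢1+i =
    kept′ (swapVal-other a≢i a≢1+i) (swapVal-other c≢i c≢1+i) refl

Adjacent : {A : Set} → A → A → List A → Set
Adjacent a b = Infix _≡_ (a ∷ b ∷ [])

module _ {A : Set} where

  adjacent⇒⊆ : ∀ {a b : A} {L} → Adjacent a b L → a ∷ b ∷ [] ⊆ L
  adjacent⇒⊆ (here (refl ∷ refl ∷ [])) = refl ∷ refl ∷ minimum _
  adjacent⇒⊆ (there adj)               = _ ∷ʳ adjacent⇒⊆ adj

  unique-order : ∀ {a b : A} {L} → Unique L → a ∷ b ∷ [] ⊆ L → ¬ (b ∷ a ∷ [] ⊆ L)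
  unique-order (_ ∷ u) (_ ∷ʳ p)    (_ ∷ʳ q)    = unique-order u p q
  unique-order u       (refl ∷ _)  (_ ∷ʳ q)    = Unique.Unique[x∷xs]⇒x∉xs u (lookup q (there (here refl)))
  unique-order u       (refl ∷ p)  (refl ∷ _)  = Unique.Unique[x∷xs]⇒x∉xs u (lookup p (here refl))
  unique-order u       (_ ∷ʳ p)    (refl ∷ _)  = Unique.Unique[x∷xs]⇒x∉xs u (lookup p (there (here refl)))

  adjacent-unique : ∀ {a b c : A} {L} → Unique L → Adjacent a b L → Adjacent a c L → b ≡ c
  adjacent-unique _       (here (refl ∷ refl ∷ [])) (here (refl ∷ refl ∷ [])) = refl
  adjacent-unique u       (here (refl ∷ _))         (there q)                 =
    ⊥-elim (Unique.Unique[x∷xs]⇒x∉xs u (lookup (adjacent⇒⊆ q) (here refl)))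
  adjacent-unique u       (there p)                 (here (refl ∷ _))         =
    ⊥-elim (Unique.Unique[x∷xs]⇒x∉xs u (lookup (adjacent⇒⊆ p) (here refl)))
  adjacent-unique (_ ∷ u) (there p)                 (there q)                 = adjacent-unique u p q

  ∈-drop-middle : ∀ us {vs} {v x : A} → v ∈ us ++ x ∷ vs → v ≢ x → v ∈ us ++ vs
  ∈-drop-middle us v∈ v≢x with ∈-++⁻ us v∈
  ... | inj₁ v∈us         = ∈-++⁺ˡ v∈us
  ... | inj₂ (here v≡x)   = ⊥-elim (v≢x v≡x)
  ... | inj₂ (there v∈vs) = ∈-++⁺ʳ us v∈vs

  length-middle : ∀ (us : List A) x vs → length (us ++ x ∷ vs) ≡ suc (length (us ++ vs))
  length-middle us x vs = begin
    length (us ++ x ∷ vs)          ≡⟨ length-++ us ⟩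
    length us + suc (length vs)    ≡⟨ +-suc (length us) (length vs) ⟩
    suc (length us + length vs)    ≡⟨ cong suc (length-++ us) ⟨
    suc (length (us ++ vs))        ∎

  unique-⊆⇒length-≤ : ∀ {xs ys : List A} → Unique xs → (∀ {v} → v ∈ xs → v ∈ ys) →
                      length xs ≤ length ys
  unique-⊆⇒length-≤ {[]}     _          _   = z≤n
  unique-⊆⇒length-≤ {x ∷ xs} (x∉ ∷ uxs) sub with ∈-∃++ (sub (here refl))
  ... | us , vs , refl =
    subst (suc (length xs) ≤_) (sym (length-middle us x vs)) (s≤s (unique-⊆⇒length-≤ uxs sub′))
    where
    sub′ : ∀ {v} → v ∈ xs → v ∈ us ++ vs
    sub′ v∈ = ∈-drop-middle us (sub (there v∈)) (λ v≡x → All.lookup x∉ v∈ (sym v≡x))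

  filter-length-≤ : ∀ {P Q : A → Set} (P? : Decidable P) (Q? : Decidable Q) {xs} (f : A → A) →
                    (∀ {x y} → f x ≡ f y → x ≡ y) → Unique xs →
                    (∀ {x} → x ∈ xs → P x → f x ∈ xs × Q (f x)) →
                    length (filter P? xs) ≤ length (filter Q? xs)
  filter-length-≤ P? Q? {xs} f f-inj uxs maps =
    subst (_≤ length (filter Q? xs)) (length-map f (filter P? xs))
      (unique-⊆⇒length-≤ (Unique.map⁺ f-inj (Unique.filter⁺ P? uxs)) image⊆)
    where
    image⊆ : ∀ {v} → v ∈ map f (filter P? xs) → v ∈ filter Q? xs
    image⊆ v∈ with ∈-map⁻ f v∈
    ... | x , x∈ , refl with ∈-filter⁻ P? x∈
    ...   | x∈xs , px with maps x∈xs px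
    ...     | fx∈xs , qfx = ∈-filter⁺ Q? fx∈xs qfx

Avoids : List ℕ → Set
Avoids st = avoids132 st ≡ true

avoids-tail : ∀ {t} st → Avoids (t ∷ st) → Avoids st
avoids-tail []          _  = refl
avoids-tail (_ ∷ [])    _  = refl
avoids-tail (_ ∷ _ ∷ _) ok = ∧-conicalʳ _ _ ok

avoids-push : ∀ {x t u r} → ((x <ᵇ u) ∧ (u <ᵇ t)) ≡ false →
              Avoids (t ∷ u ∷ r) → Avoids (x ∷ t ∷ u ∷ r)
avoids-push no132 ok rewrite no132 = ok

avoids-push-pred : ∀ {i r} → Avoids (suc i ∷ r) → Avoids (i ∷ suc i ∷ r)
avoids-push-pred {r = []}        _  = refl
avoids-push-pred {i} {r = x ∷ _} ok rewrite nothing-between i x = ok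

-- A view rather than `with avoids132 … in eq`: the latter would also abstract the
-- test inside the unfolded `run` in goals and hypotheses.
data PushOrPop (x t : ℕ) (rest : List ℕ) : Set where
  push : Avoids (x ∷ t ∷ rest) → PushOrPop x t rest
  pop  : avoids132 (x ∷ t ∷ rest) ≡ false → PushOrPop x t rest

pushOrPop : ∀ x t rest → PushOrPop x t rest
pushOrPop x t rest with avoids132 (x ∷ t ∷ rest) in test
... | true  = push test
... | false = pop test

run-push : ∀ x xs st → Avoids (x ∷ st) → run (x ∷ xs) st ≡ run xs (x ∷ st)
run-push x xs []         _      = refl
run-push x xs (t ∷ rest) pushes rewrite pushes = refl

run-pop : ∀ x xs t rest → avoids132 (x ∷ t ∷ rest) ≡ false →
          run (x ∷ xs) (t ∷ rest) ≡ t ∷ run (x ∷ xs) rest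
run-pop x xs t rest pops rewrite pops with popUntil x rest
... | _ , _ = refl

run-sublist : ∀ σ st → st ⊆ run σ st
run-sublist []       st = ⊆-refl
run-sublist (x ∷ xs) = go
  where
  go : ∀ st → st ⊆ run (x ∷ xs) st
  go []         = minimum _
  go (t ∷ rest) with pushOrPop x t rest
  ... | push pushes = subst (t ∷ rest ⊆_) (sym (run-push x xs (t ∷ rest) pushes))
                        (∷ˡ⁻ (run-sublist xs (x ∷ t ∷ rest)))
  ... | pop pops    = subst (t ∷ rest ⊆_) (sym (run-pop x xs t rest pops)) (refl ∷ go rest)

run-adjacent : ∀ {a b} → a ≤ b → ∀ σ st → Avoids st → Adjacent a b st → Adjacent a b (run σ st)
run-adjacent a≤b []       st _ adj = adj
run-adjacent {a} {b} a≤b (x ∷ xs) = go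
  where
  go : ∀ st → Avoids st → Adjacent a b st → Adjacent a b (run (x ∷ xs) st)
  go []           _ (here ())
  go (_ ∷ [])     _ (here (_ ∷ ()))
  go (_ ∷ _ ∷ r) ok top@(here (refl ∷ refl ∷ [])) =
    subst (Adjacent a b) (sym (run-push x xs (a ∷ b ∷ r) pushes)) (run-adjacent a≤b xs _ pushes (there top))
    where
    pushes : Avoids (x ∷ a ∷ b ∷ r)
    pushes = avoids-push {x} {a} {b} {r} (∧-false-right (x <ᵇ b) (≤⇒≮ᵇ a≤b)) ok
  go (t ∷ rest) ok (there adj) with pushOrPop x t rest
  ... | push pushes = subst (Adjacent a b) (sym (run-push x xs (t ∷ rest) pushes))
                        (run-adjacent a≤b xs (x ∷ t ∷ rest) pushes (there (there adj)))
  ... | pop pops    = subst (Adjacent a b) (sym (run-pop x xs t rest pops))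
                        (there (go rest (avoids-tail rest ok) adj))

run-upper-onto-lower : ∀ i xs t r → Avoids (t ∷ i ∷ r) →
                       suc i ∷ i ∷ [] ⊆ run (suc i ∷ xs) (t ∷ i ∷ r)
run-upper-onto-lower i xs t r ok =
  subst (suc i ∷ i ∷ [] ⊆_) (sym (run-push (suc i) xs (t ∷ i ∷ r) pushes))
    (⊆-trans (refl ∷ t ∷ʳ refl ∷ minimum r) (run-sublist xs (suc i ∷ t ∷ i ∷ r)))
  where
  pushes : Avoids (suc i ∷ t ∷ i ∷ r)
  pushes = avoids-push {suc i} {t} {i} {r} (cong (_∧ (i <ᵇ t)) (≤⇒≮ᵇ (n≤1+n i))) ok

run-lower-onto-upper : ∀ i xs t r → (suc i <ᵇ t) ≡ true → Avoids (t ∷ suc i ∷ r) →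
                       Adjacent i (suc i) (run (i ∷ xs) (t ∷ suc i ∷ r))
run-lower-onto-upper i xs t r 1+i<t ok =
  subst (Adjacent i (suc i)) (sym popThenPush)
    (there (run-adjacent (n≤1+n i) xs (i ∷ suc i ∷ r) pushes (here (refl ∷ refl ∷ []))))
  where
  pops : avoids132 (i ∷ t ∷ suc i ∷ r) ≡ false
  pops = cong (λ p → not p ∧ avoids132 (t ∷ suc i ∷ r)) (cong₂ _∧_ (n<ᵇ1+n i) 1+i<t)
  pushes : Avoids (i ∷ suc i ∷ r)
  pushes = avoids-push-pred {i} {r} (avoids-tail (suc i ∷ r) ok)
  popThenPush : run (i ∷ xs) (t ∷ suc i ∷ r) ≡ t ∷ run xs (i ∷ suc i ∷ r)
  popThenPush = trans (run-pop i xs t (suc i ∷ r) pops) (cong (t ∷_) (run-push i xs (suc i ∷ r) pushes))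

Apart : ℕ → List ℕ → Set
Apart i L = ¬ (suc i ∷ i ∷ [] ⊆ L) × ¬ Adjacent i (suc i) L

Apart-tail : ∀ {i t L} → Apart i (t ∷ L) → Apart i L
Apart-tail (¬desc , ¬adj) = (λ desc → ¬desc (_ ∷ʳ desc)) , (λ adj → ¬adj (there adj))

apart-of-gap : ∀ {i} as m mid ds → Unique (as ++ i ∷ m ∷ mid ++ suc i ∷ ds) →
               Apart i (as ++ i ∷ m ∷ mid ++ suc i ∷ ds)
apart-of-gap {i} as m mid ds u = unique-order u ascending , ¬adjacent
  where
  ascending : i ∷ suc i ∷ [] ⊆ as ++ i ∷ m ∷ mid ++ suc i ∷ ds
  ascending = ++⁺ˡ as (refl ∷ m ∷ʳ ++⁺ˡ mid (refl ∷ minimum ds))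
  ¬adjacent : ¬ Adjacent i (suc i) (as ++ i ∷ m ∷ mid ++ suc i ∷ ds)
  ¬adjacent adj with adjacent-unique u adj (as ++ⁱ here (refl ∷ refl ∷ []))
  ... | refl = unique-order u twice twice
    where
    twice : suc i ∷ suc i ∷ [] ⊆ as ++ i ∷ suc i ∷ mid ++ suc i ∷ ds
    twice = ++⁺ˡ as (i ∷ʳ refl ∷ ++⁺ˡ mid (refl ∷ minimum ds))

module _ (i : ℕ) where

  private
    sw : ℕ → ℕ
    sw = swapVal i

  pushTest-swap : ∀ x xs t rest → Avoids (t ∷ rest) → Avoids (map sw (t ∷ rest)) →
                  Apart i (run (x ∷ xs) (t ∷ rest)) →
                  avoids132 (map sw (x ∷ t ∷ rest)) ≡ avoids132 (x ∷ t ∷ rest)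
  pushTest-swap x xs t []      _  _   _                = refl
  pushTest-swap x xs t (u ∷ r) ok ok′ (¬desc , ¬adj) with orderUnderSwap i u t
  ... | ascent  = ⊥-elim (¬desc (⊆-trans (refl ∷ refl ∷ minimum r) (run-sublist (x ∷ xs) _)))
  ... | descent = ⊥-elim (¬adj (run-adjacent (n≤1+n i) (x ∷ xs) _ ok (here (refl ∷ refl ∷ []))))
  ... | kept ut with orderUnderSwap i x u
  ...   | kept xu = cong₂ (λ p q → not p ∧ q) (cong₂ _∧_ xu ut) (trans ok′ (sym ok))
  ...   | descent = ⊥-elim (¬desc (run-upper-onto-lower i xs t r ok))
  ...   | ascent with (suc i <ᵇ t) ≟ᵇ true
  ...     | yes 1+i<t = ⊥-elim (¬adj (run-lower-onto-upper i xs t r 1+i<t ok))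
  ...     | no 1+i≮t  = cong₂ (λ p q → not p ∧ q)
                          (trans (∧-false-right (sw i <ᵇ sw (suc i)) (trans ut (¬-not 1+i≮t)))
                                 (sym (∧-false-right (i <ᵇ suc i) (¬-not 1+i≮t))))
                          (trans ok′ (sym ok))

  run-swap : ∀ σ st → Avoids st → Avoids (map sw st) → Apart i (run σ st) →
             run (map sw σ) (map sw st) ≡ map sw (run σ st)
  run-swap []       st _ _ _ = refl
  run-swap (x ∷ xs) = go
    where
    go : ∀ st → Avoids st → Avoids (map sw st) → Apart i (run (x ∷ xs) st) →
         run (map sw (x ∷ xs)) (map sw st) ≡ map sw (run (x ∷ xs) st)
    go []         _  _   apart = run-swap xs (x ∷ []) refl refl apart
    go (t ∷ rest) ok ok′ apart with pushOrPop x t rest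
    ... | push pushes = begin
          run (map sw (x ∷ xs)) (map sw (t ∷ rest))  ≡⟨ run-push (sw x) (map sw xs) (map sw (t ∷ rest)) pushes′ ⟩
          run (map sw xs) (map sw (x ∷ t ∷ rest))    ≡⟨ run-swap xs _ pushes pushes′ apart′ ⟩
          map sw (run xs (x ∷ t ∷ rest))             ≡⟨ cong (map sw) pushed ⟨
          map sw (run (x ∷ xs) (t ∷ rest))           ∎
      where
      pushed : run (x ∷ xs) (t ∷ rest) ≡ run xs (x ∷ t ∷ rest)
      pushed = run-push x xs (t ∷ rest) pushes
      apart′ : Apart i (run xs (x ∷ t ∷ rest))
      apart′ = subst (Apart i) pushed apart
      pushes′ : Avoids (map sw (x ∷ t ∷ rest))
      pushes′ = trans (pushTest-swap x xs t rest ok ok′ apart) pushes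
    ... | pop pops = begin
          run (map sw (x ∷ xs)) (map sw (t ∷ rest))  ≡⟨ run-pop (sw x) (map sw xs) (sw t) (map sw rest) pops′ ⟩
          sw t ∷ run (map sw (x ∷ xs)) (map sw rest) ≡⟨ cong (sw t ∷_) (go rest ok-rest ok′-rest apart′) ⟩
          map sw (t ∷ run (x ∷ xs) rest)             ≡⟨ cong (map sw) popped ⟨
          map sw (run (x ∷ xs) (t ∷ rest))           ∎
      where
      popped : run (x ∷ xs) (t ∷ rest) ≡ t ∷ run (x ∷ xs) rest
      popped = run-pop x xs t rest pops
      apart′ : Apart i (run (x ∷ xs) rest)
      apart′ = Apart-tail (subst (Apart i) popped apart)
      pops′ : avoids132 (map sw (x ∷ t ∷ rest)) ≡ false
      pops′ = trans (pushTest-swap x xs t rest ok ok′ apart) pops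
      ok-rest : Avoids rest
      ok-rest = avoids-tail rest ok
      ok′-rest : Avoids (map sw rest)
      ok′-rest = avoids-tail {sw t} (map sw rest) ok′

  SC132-swapVals : ∀ σ → Apart i (SC132 σ) → SC132 (swapVals i σ) ≡ swapVals i (SC132 σ)
  SC132-swapVals σ = run-swap σ [] refl refl

words-suc : ∀ (as : List ℕ) k → words as (suc k) ≡ cartesianProductWith _∷_ as (words as k)
words-suc as k = concatMap≡cartesianProductWith as
  where
  concatMap≡cartesianProductWith : ∀ bs → concatMap (λ b → map (b ∷_) (words as k)) bs ≡
                                          cartesianProductWith _∷_ bs (words as k)
  concatMap≡cartesianProductWith []       = refl
  concatMap≡cartesianProductWith (b ∷ bs) =
    cong (map (b ∷_) (words as k) ++_) (concatMap≡cartesianProductWith bs)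

words-unique : ∀ {as} → Unique as → ∀ k → Unique (words as k)
words-unique uas zero    = All.[] ∷ []
words-unique {as} uas (suc k) = subst Unique (sym (words-suc as k))
  (Unique.cartesianProductWith⁺ _∷_ ∷-injective uas (words-unique uas k))

map-∈-words : ∀ {as f} → (∀ {a} → a ∈ as → f a ∈ as) →
              ∀ k {w} → w ∈ words as k → map f w ∈ words as k
map-∈-words closed zero    (here refl) = here refl
map-∈-words {as} {f} closed (suc k) w∈
  with ∈-cartesianProductWith⁻ _∷_ as (words as k) (subst (_ ∈_) (words-suc as k) w∈)
... | a , w′ , a∈ , w′∈ , refl = subst (_ ∈_) (sym (words-suc as k))
  (∈-cartesianProductWith⁺ _∷_ (closed a∈) (map-∈-words closed k w′∈))

Sn⇒unique : ∀ n {σ} → σ ∈ Sn n → Unique σ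
Sn⇒unique n σ∈ = proj₂ (∈-filter⁻ unique? {xs = words [ n ] n} σ∈)

Sn-unique : ∀ n → Unique (Sn n)
Sn-unique n = Unique.filter⁺ unique? (words-unique (Unique.map⁺ suc-injective (Unique.upTo⁺ n)) n)

∈-[n] : ∀ {m n} → 1 ≤ m → m ≤ n → m ∈ [ n ]
∈-[n] (s≤s z≤n) m≤n = ∈-map⁺ suc (∈-upTo⁺ m≤n)

swapVals-∈-Sn : ∀ {n i σ} → 1 ≤ i → i < n → σ ∈ Sn n → swapVals i σ ∈ Sn n
swapVals-∈-Sn {n} {i} {σ} 1≤i i<n σ∈ =
  ∈-filter⁺ unique?
    (map-∈-words (swapVal-∈ i (∈-[n] 1≤i (<⇒≤ i<n)) (∈-[n] (s≤s z≤n) i<n)) n σ∈words)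
    (Unique.map⁺ (swapVal-injective i) (Sn⇒unique n σ∈))
  where
  σ∈words : σ ∈ words [ n ] n
  σ∈words = proj₁ (∈-filter⁻ unique? σ∈)

lemma4p5 : (n : ℕ) (π : List ℕ) → π ∈ Sn n →
           (i : ℕ) → 1 ≤ i → i < n →
           (as mid ds : List ℕ) → mid ≢ [] →
           π ≡ as ++ i ∷ mid ++ suc i ∷ ds →
           preimageCount n π ≤ preimageCount n (swapVals i π)
lemma4p5 n π π∈Sn i 1≤i i<n as []        ds mid≢[] _   = ⊥-elim (mid≢[] refl)
lemma4p5 n π π∈Sn i 1≤i i<n as (m ∷ mid) ds _      π≡ =
  filter-length-≤ (λ σ → SC132 σ ≡? π) (λ σ → SC132 σ ≡? swapVals i π)
    (swapVals i) (map-injective (swapVal-injective i)) (Sn-unique n) swapped-preimage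
  where
  apart : Apart i π
  apart = subst (Apart i) (sym π≡) (apart-of-gap as m mid ds (subst Unique π≡ (Sn⇒unique n π∈Sn)))
  swapped-preimage : ∀ {σ} → σ ∈ Sn n → SC132 σ ≡ π →
                     swapVals i σ ∈ Sn n × SC132 (swapVals i σ) ≡ swapVals i π
  swapped-preimage {σ} σ∈ sc≡π =
    swapVals-∈-Sn 1≤i i<n σ∈ ,
    trans (SC132-swapVals i σ (subst (Apart i) (sym sc≡π) apart)) (cong (swapVals i) sc≡π)
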